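{- Let $X$ be a transitive $G$-graph and let $v\in V(X)$. Then the quotient graph $X/G'$ is (isomorphic to) a Cayley graph of the group $G/(G'\,\mathrm{St}_G(v))$.
   Context: A $G$-graph is a graph $X$ with an injective homomorphism $G\to\mathrm{Aut}(X)$; it is transitive if $G$ acts transitively on $V(X)$. $G'$ is the commutator subgroup of $G$ and $\mathrm{St}_G(v)$ the stabilizer of $v$; $G'\,\mathrm{St}_G(v)$ is a normal subgroup of $G$ since $G/G'$ is abelian. The quotient graph $X/G'$ has the $G'$-orbits as vertices, with $G'x$ and $G'y$ adjacent iff some edge of $X$ joins a vertex of $G'x$ to a vertex of $G'y$. -}

module Defs where

open import Level using (0ℓ)
open import Algebra.Bundles using (Group)
open import Data.Product using (Σ; ∃; _×_; _,_)
open import Relation.Binary.PropositionalEquality using (_≡_)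
open import Relation.Nullary using (¬_)

-- A graph whose vertex set is given as a type together with an
-- equivalence relation (used to represent quotients), and an
-- adjacency relation on representatives.
record SetoidGraph : Set₁ where
  field
    Vertex : Set
    _≃_    : Vertex → Vertex → Set
    Adj    : Vertex → Vertex → Set

record _≅_ (A B : SetoidGraph) : Set where
  private
    module A = SetoidGraph A
    module B = SetoidGraph B
  field
    to        : A.Vertex → B.Vertex
    from      : B.Vertex → A.Vertex
    to-cong   : ∀ {x y} → x A.≃ y → to x B.≃ to y
    from-cong : ∀ {x y} → x B.≃ y → from x A.≃ from y
    to-from   : ∀ y → to (from y) B.≃ y
    from-to   : ∀ x → from (to x) A.≃ x
    adj-to    : ∀ {x y} → A.Adj x y → B.Adj (to x) (to y)
    adj-from  : ∀ {x y} → B.Adj (to x) (to y) → A.Adj x y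

module _ (G : Group 0ℓ 0ℓ) where
  open Group G

  record GGraph : Set₁ where
    field
      V     : Set
      E     : V → V → Set
      E-sym : ∀ {x y} → E x y → E y x
      E-irr : ∀ {x} → ¬ E x x
      act      : Carrier → V → V
      act-cong : ∀ {g h} → g ≈ h → ∀ x → act g x ≡ act h x
      act-ε    : ∀ x → act ε x ≡ x
      act-∙    : ∀ g h x → act (g ∙ h) x ≡ act g (act h x)
      act-E    : ∀ g {x y} → E x y → E (act g x) (act g y)
      act-E⁻   : ∀ g {x y} → E (act g x) (act g y) → E x y
      faithful : ∀ {g h} → (∀ x → act g x ≡ act h x) → g ≈ h

  IsTransitive : GGraph → Set
  IsTransitive X = ∀ x y → ∃ λ g → act g x ≡ y
    where open GGraph X

  data InDerived : Carrier → Set where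
    comm : ∀ x y → InDerived (((x ⁻¹) ∙ (y ⁻¹)) ∙ (x ∙ y))
    one  : InDerived ε
    mul  : ∀ {a b} → InDerived a → InDerived b → InDerived (a ∙ b)
    inv  : ∀ {a} → InDerived a → InDerived (a ⁻¹)
    resp : ∀ {a b} → a ≈ b → InDerived a → InDerived b

  module _ (X : GGraph) where
    open GGraph X

    InStab : V → Carrier → Set
    InStab v g = act g v ≡ v

    InDerivedStab : V → Carrier → Set
    InDerivedStab v g = Σ Carrier λ k → Σ Carrier λ s →
      InDerived k × InStab v s × (g ≈ (k ∙ s))

    QuotientGraph : SetoidGraph
    QuotientGraph = record
      { Vertex = V
      ; _≃_    = λ x y → ∃ λ k → InDerived k × act k x ≡ y
      ; Adj    = λ x y → Σ V λ x' → Σ V λ y' →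
          (∃ λ k → InDerived k × act k x ≡ x') ×
          (∃ λ k → InDerived k × act k y ≡ y') × E x' y'
      }

  -- Cayley graph Cay(G/N, S) of the quotient group G/N, where N is
  -- given by its membership predicate; elements of G/N are represented
  -- by elements of G, with x ≃ y iff x⁻¹y ∈ N, and S ⊆ G is a union of
  -- N-cosets representing the connection set. x ~ y iff x⁻¹y ∈ S.
  CayleyQuot : (N : Carrier → Set) (S : Carrier → Set) → SetoidGraph
  CayleyQuot N S = record
    { Vertex = Carrier
    ; _≃_    = λ x y → N ((x ⁻¹) ∙ y)
    ; Adj    = λ x y → S ((x ⁻¹) ∙ y)
    }

  IsQuotConnSet : (N : Carrier → Set) (S : Carrier → Set) → Set
  IsQuotConnSet N S =
    (∀ {x y} → N ((x ⁻¹) ∙ y) → S x → S y) × (∀ x → S x → S (x ⁻¹))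

{-# OPTIONS --safe #-}
module Submission where

-- Transitivity identifies V(X) with G / St(v) through g ↦ g v.  Because G' is
-- normal, g v and h v lie in the same G'-orbit iff g⁻¹ h ∈ G' St(v), so the
-- G'-orbits are the cosets of G' St(v).  The adjacency of X / G' is
-- G-invariant, so g v and h v are adjacent there iff v and g⁻¹ h v are: it is
-- the Cayley adjacency for S = { h ∣ v and h v are adjacent in X / G' }.

open import Defs
open import Level using (0ℓ)
open import Algebra.Bundles using (Group)
open import Data.Product using (Σ; _×_; _,_; proj₁; proj₂)
open import Relation.Binary.PropositionalEquality
  using (_≡_; refl; sym; cong; subst; subst₂; module ≡-Reasoning)

module _ (G : Group 0ℓ 0ℓ) where
  open Group G
  open import Algebra.Properties.Group G using (⁻¹-involutive; \\-leftDividesˡ)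
  open import Relation.Binary.Reasoning.Setoid setoid

  InDerived-conj : ∀ g {k} → InDerived G k → InDerived G ((g ∙ k) ∙ g ⁻¹)
  InDerived-conj g {k} k∈G' = resp k∙[k,g⁻¹]≈gkg⁻¹ (mul k∈G' (comm k (g ⁻¹)))
    where
    k∙[k,g⁻¹]≈gkg⁻¹ : k ∙ ((k ⁻¹ ∙ (g ⁻¹) ⁻¹) ∙ (k ∙ g ⁻¹)) ≈ (g ∙ k) ∙ g ⁻¹
    k∙[k,g⁻¹]≈gkg⁻¹ = begin
      k ∙ ((k ⁻¹ ∙ (g ⁻¹) ⁻¹) ∙ (k ∙ g ⁻¹))  ≈⟨ ∙-congˡ (assoc _ _ _) ⟩
      k ∙ (k ⁻¹ ∙ ((g ⁻¹) ⁻¹ ∙ (k ∙ g ⁻¹)))  ≈⟨ \\-leftDividesˡ k _ ⟩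
      (g ⁻¹) ⁻¹ ∙ (k ∙ g ⁻¹)                 ≈⟨ ∙-congʳ (⁻¹-involutive g) ⟩
      g ∙ (k ∙ g ⁻¹)                         ≈⟨ assoc g k (g ⁻¹) ⟨
      (g ∙ k) ∙ g ⁻¹                         ∎

module _ {G : Group 0ℓ 0ℓ} (X : GGraph G) where
  open Group G using (Carrier; _∙_; _⁻¹; ε; inverseˡ)
  open import Algebra.Properties.Group G using (\\-leftDividesˡ)
  open GGraph X
  open SetoidGraph (QuotientGraph G X) using (Adj) renaming (_≃_ to _∼_)
  open ≡-Reasoning

  act-⁻¹-act : ∀ g x → act (g ⁻¹) (act g x) ≡ x
  act-⁻¹-act g x = begin
    act (g ⁻¹) (act g x)  ≡⟨ act-∙ (g ⁻¹) g x ⟨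
    act (g ⁻¹ ∙ g) x      ≡⟨ act-cong (inverseˡ g) x ⟩
    act ε x               ≡⟨ act-ε x ⟩
    x                     ∎

  act-leftDivides : ∀ g h x → act g (act (g ⁻¹ ∙ h) x) ≡ act h x
  act-leftDivides g h x = begin
    act g (act (g ⁻¹ ∙ h) x)  ≡⟨ act-∙ g (g ⁻¹ ∙ h) x ⟨
    act (g ∙ (g ⁻¹ ∙ h)) x    ≡⟨ act-cong (\\-leftDividesˡ g h) x ⟩
    act h x                   ∎

  ≡⇒∼ : ∀ {x y} → x ≡ y → x ∼ y
  ≡⇒∼ {x} refl = ε , one , act-ε x

  ∼-sym : ∀ {x y} → x ∼ y → y ∼ x
  ∼-sym {x} (k , k∈G' , refl) = k ⁻¹ , inv k∈G' , act-⁻¹-act k x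

  ∼-trans : ∀ {x y z} → x ∼ y → y ∼ z → x ∼ z
  ∼-trans {x} (k , k∈G' , refl) (l , l∈G' , refl) = l ∙ k , mul l∈G' k∈G' , act-∙ l k x

  ∼-act : ∀ g {x y} → x ∼ y → act g x ∼ act g y
  ∼-act g {x} (k , k∈G' , refl) = (g ∙ k) ∙ g ⁻¹ , InDerived-conj G g k∈G' , (begin
    act ((g ∙ k) ∙ g ⁻¹) (act g x)      ≡⟨ act-∙ (g ∙ k) (g ⁻¹) (act g x) ⟩
    act (g ∙ k) (act (g ⁻¹) (act g x))  ≡⟨ cong (act (g ∙ k)) (act-⁻¹-act g x) ⟩
    act (g ∙ k) x                       ≡⟨ act-∙ g k x ⟩
    act g (act k x)                     ∎)

  Adj-act : ∀ g {x y} → Adj x y → Adj (act g x) (act g y)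
  Adj-act g (x' , y' , x∼x' , y∼y' , e) = act g x' , act g y' , ∼-act g x∼x' , ∼-act g y∼y' , act-E g e

  Adj-sym : ∀ {x y} → Adj x y → Adj y x
  Adj-sym (x' , y' , x∼x' , y∼y' , e) = y' , x' , y∼y' , x∼x' , E-sym e

  Adj-resp-∼ : ∀ {x x' y y'} → x ∼ x' → y ∼ y' → Adj x y → Adj x' y'
  Adj-resp-∼ x∼x' y∼y' (x'' , y'' , x∼x'' , y∼y'' , e) =
    x'' , y'' , ∼-trans (∼-sym x∼x') x∼x'' , ∼-trans (∼-sym y∼y') y∼y'' , e

  module _ (v : V) where

    InDerivedStab⇒∼ : ∀ {m} → InDerivedStab G X v m → v ∼ act m v
    InDerivedStab⇒∼ {m} (k , s , k∈G' , sv≡v , m≈ks) = k , k∈G' , (begin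
      act k v            ≡⟨ cong (act k) sv≡v ⟨
      act k (act s v)    ≡⟨ act-∙ k s v ⟨
      act (k ∙ s) v      ≡⟨ act-cong m≈ks v ⟨
      act m v            ∎)

    ∼⇒InDerivedStab : ∀ {m} → v ∼ act m v → InDerivedStab G X v m
    ∼⇒InDerivedStab {m} (k , k∈G' , kv≡mv) =
      k , k ⁻¹ ∙ m , k∈G' , k⁻¹mv≡v , Group.sym G (\\-leftDividesˡ k m)
      where
      k⁻¹mv≡v : act (k ⁻¹ ∙ m) v ≡ v
      k⁻¹mv≡v = begin
        act (k ⁻¹ ∙ m) v       ≡⟨ act-∙ (k ⁻¹) m v ⟩
        act (k ⁻¹) (act m v)   ≡⟨ cong (act (k ⁻¹)) kv≡mv ⟨
        act (k ⁻¹) (act k v)   ≡⟨ act-⁻¹-act k v ⟩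
        v                      ∎

    InDerivedStab⇒orbit-∼ : ∀ {g h} → InDerivedStab G X v (g ⁻¹ ∙ h) → act g v ∼ act h v
    InDerivedStab⇒orbit-∼ {g} {h} n =
      subst (act g v ∼_) (act-leftDivides g h v) (∼-act g (InDerivedStab⇒∼ n))

    orbit-∼⇒InDerivedStab : ∀ {g h} → act g v ∼ act h v → InDerivedStab G X v (g ⁻¹ ∙ h)
    orbit-∼⇒InDerivedStab {g} {h} gv∼hv =
      ∼⇒InDerivedStab (subst₂ _∼_ (act-⁻¹-act g v) (sym (act-∙ (g ⁻¹) h v)) (∼-act (g ⁻¹) gv∼hv))

    connectionSet : Carrier → Set
    connectionSet h = Adj v (act h v)

    orbit-Adj⇒connectionSet : ∀ {g h} → Adj (act g v) (act h v) → connectionSet (g ⁻¹ ∙ h)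
    orbit-Adj⇒connectionSet {g} {h} gv∼hv =
      subst₂ Adj (act-⁻¹-act g v) (sym (act-∙ (g ⁻¹) h v)) (Adj-act (g ⁻¹) gv∼hv)

    connectionSet⇒orbit-Adj : ∀ {g h} → connectionSet (g ⁻¹ ∙ h) → Adj (act g v) (act h v)
    connectionSet⇒orbit-Adj {g} {h} s =
      subst (Adj (act g v)) (act-leftDivides g h v) (Adj-act g s)

    connectionSet-isQuotConnSet : IsQuotConnSet G (InDerivedStab G X v) connectionSet
    connectionSet-isQuotConnSet =
      (λ n → Adj-resp-∼ (≡⇒∼ refl) (InDerivedStab⇒orbit-∼ n)) ,
      (λ h s → Adj-sym (subst (Adj _) (act-⁻¹-act h v) (Adj-act (h ⁻¹) s)))

    quotient≅cayley : IsTransitive G X →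
      QuotientGraph G X ≅ CayleyQuot G (InDerivedStab G X v) connectionSet
    quotient≅cayley transitive = record
      { to        = rep
      ; from      = λ g → act g v
      ; to-cong   = λ x∼y → orbit-∼⇒InDerivedStab (subst₂ _∼_ (sym (rep-v _)) (sym (rep-v _)) x∼y)
      ; from-cong = InDerivedStab⇒orbit-∼
      ; to-from   = λ g → orbit-∼⇒InDerivedStab (≡⇒∼ (rep-v (act g v)))
      ; from-to   = λ x → ≡⇒∼ (rep-v x)
      ; adj-to    = λ x∼y → orbit-Adj⇒connectionSet (subst₂ Adj (sym (rep-v _)) (sym (rep-v _)) x∼y)
      ; adj-from  = λ s → subst₂ Adj (rep-v _) (rep-v _) (connectionSet⇒orbit-Adj s)
      }
      where
      rep : V → Carrier
      rep x = proj₁ (transitive v x)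

      rep-v : ∀ x → act (rep x) v ≡ x
      rep-v x = proj₂ (transitive v x)

mainTheorem13 : (G : Group 0ℓ 0ℓ) (X : GGraph G) → IsTransitive G X →
    (v : GGraph.V X) →
    Σ (Group.Carrier G → Set) λ S →
      IsQuotConnSet G (InDerivedStab G X v) S ×
      (QuotientGraph G X ≅ CayleyQuot G (InDerivedStab G X v) S)
mainTheorem13 G X transitive v =
  connectionSet X v , connectionSet-isQuotConnSet X v , quotient≅cayley X v transitive
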